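{- Let $\Gamma$ be a strongly regular graph with parameters $(v,k,\lambda,\mu)$, and let $d$ be an integer with $0\le d\le k$. Then there exists an integer $b$ with $R_\Gamma(b,v,d)<0$ if and only if $d\ne k$.
   Context: A graph is strongly regular with parameters $(v,k,\lambda,\mu)$ if it has $v$ vertices, is $k$-regular, is neither complete nor edgeless, every two adjacent vertices have exactly $\lambda$ common neighbours, and every two distinct non-adjacent vertices have exactly $\mu$ common neighbours. The regular adjacency polynomial is $R_\Gamma(x,y,d)=x(x+1)(v-y)-2xyk+(2x+\lambda-\mu+1)yd+y(y-1)\mu-yd^2$. -}

module Defs where

open import Data.Nat using (ℕ; zero; suc)
open import Data.Bool using (Bool; true; false; _∧_; if_then_else_)
open import Data.Fin using (Fin)
open import Data.List using (List; []; _∷_)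
open import Data.List using (allFin)
open import Data.Product using (Σ; _×_; ∃)
open import Data.Integer as ℤ using (ℤ; +_)
open import Relation.Binary.PropositionalEquality using (_≡_; _≢_)

countᵇ : {A : Set} → (A → Bool) → List A → ℕ
countᵇ p [] = zero
countᵇ p (x ∷ xs) = if p x then suc (countᵇ p xs) else countᵇ p xs

record Graph (v : ℕ) : Set where
  field
    adj       : Fin v → Fin v → Bool
    adj-sym   : ∀ i j → adj i j ≡ adj j i
    adj-irref : ∀ i → adj i i ≡ false

open Graph public

degree : {v : ℕ} → Graph v → Fin v → ℕ
degree {v} Γ i = countᵇ (adj Γ i) (allFin v)

common : {v : ℕ} → Graph v → Fin v → Fin v → ℕ
common {v} Γ i j = countᵇ (λ x → adj Γ i x ∧ adj Γ j x) (allFin v)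

record IsSRG {v : ℕ} (Γ : Graph v) (k λ' μ : ℕ) : Set where
  field
    regular      : ∀ i → degree Γ i ≡ k
    not-complete : Σ (Fin v) λ i → Σ (Fin v) λ j → i ≢ j × adj Γ i j ≡ false
    not-edgeless : Σ (Fin v) λ i → Σ (Fin v) λ j → adj Γ i j ≡ true
    adjacent     : ∀ i j → adj Γ i j ≡ true → common Γ i j ≡ λ'
    nonadjacent  : ∀ i j → i ≢ j → adj Γ i j ≡ false → common Γ i j ≡ μ

R : (v k λ' μ : ℕ) → ℤ → ℤ → ℤ → ℤ
R v k λ' μ x y d =
  x ℤ.* (x ℤ.+ + 1) ℤ.* (+ v ℤ.- y)
  ℤ.- + 2 ℤ.* x ℤ.* y ℤ.* + k
  ℤ.+ (+ 2 ℤ.* x ℤ.+ + λ' ℤ.- + μ ℤ.+ + 1) ℤ.* y ℤ.* d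
  ℤ.+ y ℤ.* (y ℤ.- + 1) ℤ.* + μ
  ℤ.- y ℤ.* d ℤ.* d

-- At y = v the cubic term of R vanishes and
--   R(x, v, d) = v · (2x(d − k) + (λ − μ + 1)d + (v − 1)μ − d²).
-- Counting the walks i ~ j ~ w with w not adjacent to i once through the
-- middle vertex j and once through the end vertex w gives the classical
-- identity k(k − λ − 1) = (v − k − 1)μ, with which the bracket factors as
-- (d − k)(2x + λ − μ + 1 − d − k). Hence R(x, v, k) = 0 for every x, while
-- for d < k the choice x = μ + k makes the second factor positive.
module Submission where

open import Defs
open import Data.Nat using (ℕ; zero; suc; _+_; _*_; z<s; NonZero; >-nonZero⁻¹)
open import Data.Integer using (ℤ; +_; _≤_; _<_)
open import Data.Product using (∃; _×_)
open import Function.Bundles using (_⇔_)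
open import Relation.Binary.PropositionalEquality using (_≢_)

open import Algebra.Properties.Semiring.Sum as Sum using ()
open import Data.Bool using (Bool; true; false; _∧_; not)
open import Data.Bool.Properties using (∧-idem)
open import Data.Fin using (Fin; zero; suc; punchIn)
open import Data.Fin.Properties using (punchInᵢ≢i; nonZeroIndex)
open import Data.Integer as ℤ using (0ℤ; +<+; _-_)
import Data.Integer.Properties as ℤ
open import Data.Integer.Tactic.RingSolver as ℤ-Solver using ()
open import Data.List using (tabulate; allFin)
import Data.Nat.Properties as ℕ
open import Data.Nat.Tactic.RingSolver as ℕ-Solver using ()
open import Data.Product using (_,_; proj₁)
open import Function using (_∘_; id)
open import Function.Bundles using (mk⇔)
open import Relation.Binary.PropositionalEquality
  using (_≡_; refl; sym; trans; cong; cong₂; subst; module ≡-Reasoning)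

open Sum ℕ.+-*-semiring
  using (sum-syntax; sum-cong-≗; sum-remove; ∑-distrib-+; ∑-comm; *-distribˡ-sum; *-distribʳ-sum)

toℕ : Bool → ℕ
toℕ true  = 1
toℕ false = 0

toℕ-∧ : ∀ p q → toℕ (p ∧ q) ≡ toℕ p * toℕ q
toℕ-∧ true  true  = refl
toℕ-∧ true  false = refl
toℕ-∧ false q     = refl

toℕ-+-toℕ-not : ∀ p → toℕ p + toℕ (not p) ≡ 1
toℕ-+-toℕ-not true  = refl
toℕ-+-toℕ-not false = refl

countᵇ-tabulate : ∀ {A : Set} (p : A → Bool) {n} (f : Fin n → A) →
                  countᵇ p (tabulate f) ≡ ∑[ x < n ] toℕ (p (f x))
countᵇ-tabulate p {zero}  f = refl
countᵇ-tabulate p {suc n} f with p (f zero)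
... | true  = cong suc (countᵇ-tabulate p (f ∘ suc))
... | false = countᵇ-tabulate p (f ∘ suc)

countᵇ-allFin : ∀ {n} (p : Fin n → Bool) → countᵇ p (allFin n) ≡ ∑[ x < n ] toℕ (p x)
countᵇ-allFin p = countᵇ-tabulate p id

∑-1≡n : ∀ n → ∑[ x < n ] 1 ≡ n
∑-1≡n zero    = refl
∑-1≡n (suc n) = cong suc (∑-1≡n n)

-- k(k − λ − 1) = (v − k − 1)μ, arranged so that no subtraction occurs.
ParameterIdentity : (v k λ' μ : ℕ) → Set
ParameterIdentity v k λ' μ = k * k + μ * (1 + k) ≡ λ' * k + k + μ * v

module WalkCount {n k λ' μ : ℕ} {Γ : Graph (suc n)} (srg : IsSRG Γ k λ' μ) (i : Fin (suc n)) where
  open IsSRG srg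
  open ≡-Reasoning

  A Ā : Fin (suc n) → Fin (suc n) → ℕ
  A x y = toℕ (adj Γ x y)
  Ā x y = toℕ (not (adj Γ x y))

  ∑-A : ∀ x → ∑[ y < suc n ] A x y ≡ k
  ∑-A x = trans (sym (countᵇ-allFin (adj Γ x))) (regular x)

  ∑-A*A : ∀ x y → ∑[ w < suc n ] (A x w * A y w) ≡ common Γ x y
  ∑-A*A x y = sym (trans (countᵇ-allFin (λ w → adj Γ x w ∧ adj Γ y w)) (sum-cong-≗ λ w → toℕ-∧ (adj Γ x w) (adj Γ y w)))

  common-self : common Γ i i ≡ k
  common-self = begin
    common Γ i i                                ≡⟨ countᵇ-allFin (λ w → adj Γ i w ∧ adj Γ i w) ⟩
    ∑[ w < suc n ] toℕ (adj Γ i w ∧ adj Γ i w)  ≡⟨ sum-cong-≗ (λ w → cong toℕ (∧-idem (adj Γ i w))) ⟩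
    ∑[ w < suc n ] A i w                        ≡⟨ ∑-A i ⟩
    k                                           ∎

  nonNeighbours : ℕ
  nonNeighbours = ∑[ w < n ] Ā i (punchIn i w)

  vertex-partition : suc n ≡ k + suc nonNeighbours
  vertex-partition = begin
    suc n                                        ≡⟨ ∑-1≡n (suc n) ⟨
    ∑[ w < suc n ] 1                             ≡⟨ sum-cong-≗ (λ w → toℕ-+-toℕ-not (adj Γ i w)) ⟨
    ∑[ w < suc n ] (A i w + Ā i w)               ≡⟨ ∑-distrib-+ (A i) (Ā i) ⟩
    ∑[ w < suc n ] A i w + ∑[ w < suc n ] Ā i w  ≡⟨ cong₂ _+_ (∑-A i) (sum-remove {i = i} (Ā i)) ⟩
    k + (Ā i i + nonNeighbours)                  ≡⟨ cong (λ b → k + (toℕ (not b) + nonNeighbours)) (adj-irref Γ i) ⟩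
    k + suc nonNeighbours                        ∎

  -- The end vertex w = i is included, since Ā i i = 1.
  walks : ℕ
  walks = ∑[ j < suc n ] (A i j * ∑[ w < suc n ] (A j w * Ā i w))

  walks-by-middle : k * λ' + walks ≡ k * k
  walks-by-middle = begin
    k * λ' + walks                                       ≡⟨ cong (λ t → t * λ' + walks) (∑-A i) ⟨
    ∑[ j < suc n ] A i j * λ' + walks                    ≡⟨ cong (_+ walks) (*-distribʳ-sum λ' (A i)) ⟩
    ∑[ j < suc n ] (A i j * λ') + walks                  ≡⟨ ∑-distrib-+ (λ j → A i j * λ') (λ j → A i j * outside j) ⟨
    ∑[ j < suc n ] (A i j * λ' + A i j * outside j)      ≡⟨ sum-cong-≗ through ⟩
    ∑[ j < suc n ] (A i j * k)                           ≡⟨ *-distribʳ-sum k (A i) ⟨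
    ∑[ j < suc n ] A i j * k                             ≡⟨ cong (_* k) (∑-A i) ⟩
    k * k                                                ∎
    where
    outside : Fin (suc n) → ℕ
    outside j = ∑[ w < suc n ] (A j w * Ā i w)

    split : ∀ j w → A j w * A i w + A j w * Ā i w ≡ A j w
    split j w = begin
      A j w * A i w + A j w * Ā i w  ≡⟨ ℕ.*-distribˡ-+ (A j w) _ _ ⟨
      A j w * (A i w + Ā i w)        ≡⟨ cong (A j w *_) (toℕ-+-toℕ-not (adj Γ i w)) ⟩
      A j w * 1                      ≡⟨ ℕ.*-identityʳ _ ⟩
      A j w                          ∎

    neighbour : ∀ j → adj Γ i j ≡ true → λ' + outside j ≡ k
    neighbour j i~j = begin
      λ' + outside j                                           ≡⟨ cong (_+ outside j) (adjacent j i (trans (adj-sym Γ j i) i~j)) ⟨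
      common Γ j i + outside j                                 ≡⟨ cong (_+ outside j) (∑-A*A j i) ⟨
      ∑[ w < suc n ] (A j w * A i w) + outside j               ≡⟨ ∑-distrib-+ (λ w → A j w * A i w) (λ w → A j w * Ā i w) ⟨
      ∑[ w < suc n ] (A j w * A i w + A j w * Ā i w)           ≡⟨ sum-cong-≗ (split j) ⟩
      ∑[ w < suc n ] A j w                                     ≡⟨ ∑-A j ⟩
      k                                                        ∎

    through : ∀ j → A i j * λ' + A i j * outside j ≡ A i j * k
    through j with adj Γ i j in i~j
    ... | false = refl
    ... | true  = begin
      1 * λ' + 1 * outside j  ≡⟨ cong₂ _+_ (ℕ.*-identityˡ λ') (ℕ.*-identityˡ (outside j)) ⟩
      λ' + outside j          ≡⟨ neighbour j i~j ⟩
      k                       ≡⟨ ℕ.*-identityˡ k ⟨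
      1 * k                   ∎

  walks-by-end : walks ≡ ∑[ w < suc n ] (Ā i w * common Γ i w)
  walks-by-end = begin
    walks                                                              ≡⟨ sum-cong-≗ (λ j → *-distribˡ-sum (A i j) (λ w → A j w * Ā i w)) ⟩
    ∑[ j < suc n ] ∑[ w < suc n ] (A i j * (A j w * Ā i w))            ≡⟨ ∑-comm (λ j w → A i j * (A j w * Ā i w)) ⟩
    ∑[ w < suc n ] ∑[ j < suc n ] (A i j * (A j w * Ā i w))            ≡⟨ sum-cong-≗ (λ w → sum-cong-≗ (reorder w)) ⟩
    ∑[ w < suc n ] ∑[ j < suc n ] (Ā i w * (A i j * A w j))            ≡⟨ sum-cong-≗ (λ w → *-distribˡ-sum (Ā i w) (λ j → A i j * A w j)) ⟨
    ∑[ w < suc n ] (Ā i w * ∑[ j < suc n ] (A i j * A w j))            ≡⟨ sum-cong-≗ (λ w → cong (Ā i w *_) (∑-A*A i w)) ⟩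
    ∑[ w < suc n ] (Ā i w * common Γ i w)                              ∎
    where
    reorder : ∀ w j → A i j * (A j w * Ā i w) ≡ Ā i w * (A i j * A w j)
    reorder w j rewrite adj-sym Γ j w =
      trans (sym (ℕ.*-assoc (A i j) (A w j) (Ā i w))) (ℕ.*-comm (A i j * A w j) (Ā i w))

  ∑-Ā*common : ∑[ w < suc n ] (Ā i w * common Γ i w) ≡ k + μ * nonNeighbours
  ∑-Ā*common = begin
    ∑[ w < suc n ] (Ā i w * common Γ i w)                              ≡⟨ sum-remove {i = i} (λ w → Ā i w * common Γ i w) ⟩
    Ā i i * common Γ i i + ∑[ w < n ] (Ā i (punchIn i w) * common Γ i (punchIn i w))
      ≡⟨ cong₂ _+_ diagonal (sum-cong-≗ (λ w → nonNeighbour (punchIn i w) (punchInᵢ≢i i w ∘ sym))) ⟩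
    k + ∑[ w < n ] (μ * Ā i (punchIn i w))                             ≡⟨ cong (λ t → k + t) (*-distribˡ-sum μ (λ w → Ā i (punchIn i w))) ⟨
    k + μ * nonNeighbours                                              ∎
    where
    diagonal : Ā i i * common Γ i i ≡ k
    diagonal rewrite adj-irref Γ i = trans (ℕ.*-identityˡ _) common-self

    nonNeighbour : ∀ w → i ≢ w → Ā i w * common Γ i w ≡ μ * Ā i w
    nonNeighbour w i≢w with adj Γ i w in i≁w
    ... | true  = sym (ℕ.*-zeroʳ μ)
    ... | false = trans (ℕ.*-identityˡ _) (trans (nonadjacent i w i≢w i≁w) (sym (ℕ.*-identityʳ μ)))

  parameter-identity : ParameterIdentity (suc n) k λ' μ
  parameter-identity = begin
    k * k + μ * (1 + k)                                    ≡⟨ cong (_+ μ * (1 + k)) walks-by-middle ⟨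
    k * λ' + walks + μ * (1 + k)                           ≡⟨ cong (λ t → k * λ' + t + μ * (1 + k)) (trans walks-by-end ∑-Ā*common) ⟩
    k * λ' + (k + μ * nonNeighbours) + μ * (1 + k)         ≡⟨ rearrange k λ' μ nonNeighbours ⟩
    λ' * k + k + μ * (k + suc nonNeighbours)               ≡⟨ cong (λ t → λ' * k + k + μ * t) vertex-partition ⟨
    λ' * k + k + μ * suc n                                 ∎
    where
    rearrange : ∀ k λ' μ m → k * λ' + (k + μ * m) + μ * (1 + k) ≡ λ' * k + k + μ * (k + suc m)
    rearrange = ℕ-Solver.solve-∀

srg-parameter-identity : ∀ {v k λ' μ} {Γ : Graph v} → IsSRG Γ k λ' μ → ParameterIdentity v k λ' μ
srg-parameter-identity {zero}  srg with IsSRG.not-edgeless srg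
... | () , _
srg-parameter-identity {suc n} srg = WalkCount.parameter-identity srg zero

parameter-identity-ℤ : ∀ {v k λ' μ} → ParameterIdentity v k λ' μ →
                       + k ℤ.* + k ℤ.+ + μ ℤ.* (+ 1 ℤ.+ + k) ≡ + λ' ℤ.* + k ℤ.+ + k ℤ.+ + μ ℤ.* + v
parameter-identity-ℤ {v} {k} {λ'} {μ} eq = begin
  + k ℤ.* + k ℤ.+ + μ ℤ.* (+ 1 ℤ.+ + k)  ≡⟨ cong₂ ℤ._+_ (ℤ.pos-* k k) (ℤ.pos-* μ (1 + k)) ⟨
  + (k * k) ℤ.+ + (μ * (1 + k))         ≡⟨ ℤ.pos-+ (k * k) (μ * (1 + k)) ⟨
  + (k * k + μ * (1 + k))               ≡⟨ cong +_ eq ⟩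
  + (λ' * k + k + μ * v)                ≡⟨ ℤ.pos-+ (λ' * k + k) (μ * v) ⟩
  + (λ' * k + k) ℤ.+ + (μ * v)          ≡⟨ cong₂ ℤ._+_ (trans (ℤ.pos-+ (λ' * k) k) (cong (ℤ._+ + k) (ℤ.pos-* λ' k))) (ℤ.pos-* μ v) ⟩
  + λ' ℤ.* + k ℤ.+ + k ℤ.+ + μ ℤ.* + v  ∎
  where open ≡-Reasoning

-- The second summand is V times the defect of the parameter identity.
R-expand : ∀ V K L M x d →
  x ℤ.* (x ℤ.+ + 1) ℤ.* (V - V) - + 2 ℤ.* x ℤ.* V ℤ.* K ℤ.+ (+ 2 ℤ.* x ℤ.+ L - M ℤ.+ + 1) ℤ.* V ℤ.* d
    ℤ.+ V ℤ.* (V - + 1) ℤ.* M - V ℤ.* d ℤ.* d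
  ≡ V ℤ.* ((d - K) ℤ.* (+ 2 ℤ.* x ℤ.+ L - M ℤ.+ + 1 - d - K))
    ℤ.+ V ℤ.* ((L ℤ.* K ℤ.+ K ℤ.+ M ℤ.* V) - (K ℤ.* K ℤ.+ M ℤ.* (+ 1 ℤ.+ K)))
R-expand = ℤ-Solver.solve-∀

R-at-v-factorises : ∀ {v k λ' μ} → ParameterIdentity v k λ' μ → ∀ x d →
                    R v k λ' μ x (+ v) d ≡ + v ℤ.* ((d - + k) ℤ.* (+ 2 ℤ.* x ℤ.+ + λ' - + μ ℤ.+ + 1 - d - + k))
R-at-v-factorises {v} {k} {λ'} {μ} eq x d = begin
  R v k λ' μ x (+ v) d          ≡⟨ R-expand (+ v) (+ k) (+ λ') (+ μ) x d ⟩
  F ℤ.+ + v ℤ.* (P - Q)         ≡⟨ cong (λ t → F ℤ.+ + v ℤ.* t) (ℤ.i≡j⇒i-j≡0 (sym (parameter-identity-ℤ {v} {k} {λ'} {μ} eq))) ⟩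
  F ℤ.+ + v ℤ.* 0ℤ              ≡⟨ cong (λ t → F ℤ.+ t) (ℤ.*-zeroʳ (+ v)) ⟩
  F ℤ.+ 0ℤ                      ≡⟨ ℤ.+-identityʳ F ⟩
  F                             ∎
  where
  open ≡-Reasoning
  F = + v ℤ.* ((d - + k) ℤ.* (+ 2 ℤ.* x ℤ.+ + λ' - + μ ℤ.+ + 1 - d - + k))
  P = + λ' ℤ.* + k ℤ.+ + k ℤ.+ + μ ℤ.* + v
  Q = + k ℤ.* + k ℤ.+ + μ ℤ.* (+ 1 ℤ.+ + k)

R-vanishes-at-degree : ∀ {v k λ' μ} → ParameterIdentity v k λ' μ → ∀ x →
                       R v k λ' μ x (+ v) (+ k) ≡ 0ℤ
R-vanishes-at-degree {v} {k} {λ'} {μ} eq x =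
  trans (R-at-v-factorises eq x (+ k))
        (trans (cong (λ t → + v ℤ.* (t ℤ.* G)) (ℤ.+-inverseʳ (+ k))) (ℤ.*-zeroʳ (+ v)))
  where
  G = + 2 ℤ.* x ℤ.+ + λ' - + μ ℤ.+ + 1 - + k - + k

i<j⇒i-j<0 : ∀ {i j} → i < j → i - j < 0ℤ
i<j⇒i-j<0 {i} {j} i<j = subst (i - j <_) (ℤ.+-inverseʳ j) (ℤ.+-monoˡ-< (ℤ.- j) i<j)

neg*pos<0 : ∀ {i j} → i < 0ℤ → 0ℤ < j → i ℤ.* j < 0ℤ
neg*pos<0 {j = j} i<0 0<j = ℤ.*-monoʳ-<-pos j {{ℤ.positive 0<j}} i<0

pos*neg<0 : ∀ {i j} → 0ℤ < i → j < 0ℤ → i ℤ.* j < 0ℤ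
pos*neg<0 {i} 0<i j<0 = subst (i ℤ.* _ <_) (ℤ.*-zeroʳ i) (ℤ.*-monoˡ-<-pos i {{ℤ.positive 0<i}} j<0)

second-factor-at-μ+k : ∀ K L M d → + 2 ℤ.* (M ℤ.+ K) ℤ.+ L - M ℤ.+ + 1 - d - K ≡ (K - d) ℤ.+ (+ 1 ℤ.+ M ℤ.+ L)
second-factor-at-μ+k = ℤ-Solver.solve-∀

R-negative-below-degree : ∀ {v k λ' μ} → ParameterIdentity v k λ' μ → .{{NonZero v}} →
                          ∀ {d} → d < + k → R v k λ' μ (+ μ ℤ.+ + k) (+ v) d < 0ℤ
R-negative-below-degree {v} {k} {λ'} {μ} eq {d} d<k =
  subst (_< 0ℤ) (sym (R-at-v-factorises eq (+ μ ℤ.+ + k) d))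
        (pos*neg<0 (+<+ (>-nonZero⁻¹ v)) (neg*pos<0 (i<j⇒i-j<0 d<k) second-factor-positive))
  where
  second-factor-positive : 0ℤ < + 2 ℤ.* (+ μ ℤ.+ + k) ℤ.+ + λ' - + μ ℤ.+ + 1 - d - + k
  second-factor-positive =
    subst (0ℤ <_) (sym (second-factor-at-μ+k (+ k) (+ λ') (+ μ) d))
          (ℤ.+-mono-≤-< (ℤ.i≤j⇒0≤j-i (ℤ.<⇒≤ d<k)) (+<+ z<s))

lemma5p4 : (v k λ' μ : ℕ) (Γ : Graph v) → IsSRG Γ k λ' μ →
    (d : ℤ) → + 0 ≤ d → d ≤ + k →
    (∃ λ (b : ℤ) → R v k λ' μ b (+ v) d < + 0) ⇔ (d ≢ + k)
lemma5p4 v k λ' μ Γ srg d _ d≤k = mk⇔ below-degree negative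
  where
  identity : ParameterIdentity v k λ' μ
  identity = srg-parameter-identity srg

  instance
    v≢0 : NonZero v
    v≢0 = nonZeroIndex (proj₁ (IsSRG.not-edgeless srg))

  below-degree : (∃ λ b → R v k λ' μ b (+ v) d < 0ℤ) → d ≢ + k
  below-degree (b , R<0) refl = ℤ.<-irrefl (R-vanishes-at-degree identity b) R<0

  negative : d ≢ + k → ∃ λ b → R v k λ' μ b (+ v) d < 0ℤ
  negative d≢k = + μ ℤ.+ + k , R-negative-below-degree {v} {k} {λ'} {μ} identity (ℤ.≤∧≢⇒< d≤k d≢k)
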